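{- Let $\ell$ be a voltage assignment with values in a group $N$ on a graph $\widetilde\Delta$ without isolated vertices, and let $\widetilde\Gamma$ be the lift of $\widetilde\Delta$ with respect to $\ell$. Then the following are equivalent: (i) for all vertices $u,v,w$ of $\widetilde\Delta$ with $u\sim v$ and $v\perp w$, we have $\ell(w,u)=\ell(w,v)$; (ii) for all vertices $(u,m),(v,n)$ of $\widetilde\Gamma$, we have $(u,m)\sim(v,n)$ if and only if $m=n$ and $u\sim v$.
   Context: Graphs are simple; $\perp$ denotes adjacency; a dart is an ordered pair of adjacent vertices. A voltage assignment is a map $\ell$ from darts to $N$ with $\ell(u,v)=\ell(v,u)^{ -1}$; the lift of $\widetilde\Delta$ has vertex set $V(\widetilde\Delta)\times N$ with $(u,m)\perp(v,n)$ iff $u\perp v$ and $\ell(u,v)=mn^{ -1}$. In any graph, $x\sim y$ means that $x$ and $y$ have the same set of neighbours. -}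

module Defs where

open import Level using (Level; _⊔_)
open import Data.Product using (Σ; ∃; _×_; _,_)
open import Data.Empty renaming (⊥ to Empty)
open import Relation.Binary.PropositionalEquality using (_≡_)
open import Function.Bundles using (_⇔_)
open import Algebra.Bundles using (Group)

record Graph (a b : Level) : Set (Level.suc (a ⊔ b)) where
  field
    V      : Set a
    _⊥_    : V → V → Set b
    ⊥-prop : ∀ {u v} (p q : u ⊥ v) → p ≡ q
    ⊥-sym  : ∀ {u v} → u ⊥ v → v ⊥ u
    ⊥-irr  : ∀ {u} → u ⊥ u → Empty

module _ {a b : Level} (Δ : Graph a b) where
  open Graph Δ

  SameNbrs : V → V → Set (a ⊔ b)
  SameNbrs x y = ∀ z → (x ⊥ z) ⇔ (y ⊥ z)

  NoIsolated : Set (a ⊔ b)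
  NoIsolated = ∀ u → ∃ λ v → u ⊥ v

module _ {a b c ℓ : Level} (Δ : Graph a b) (N : Group c ℓ) where
  open Graph Δ
  open Group N renaming (Carrier to G)

  record Voltage : Set (a ⊔ b ⊔ c ⊔ ℓ) where
    field
      volt     : (u v : V) → u ⊥ v → G
      volt-inv : ∀ u v (p : u ⊥ v) → volt u v p ≈ (volt v u (⊥-sym p)) ⁻¹

  LiftV : Set (a ⊔ c)
  LiftV = V × G

  LiftAdj : Voltage → LiftV → LiftV → Set (b ⊔ ℓ)
  LiftAdj L (u , m) (v , n) = Σ (u ⊥ v) λ p → Voltage.volt L u v p ≈ m ∙ n ⁻¹

  LiftSameNbrs : Voltage → LiftV → LiftV → Set (a ⊔ b ⊔ c ⊔ ℓ)
  LiftSameNbrs L x y = ∀ z → LiftAdj L x z ⇔ LiftAdj L y z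

{-# OPTIONS --safe #-}
-- The lift of a dart (u , z) at (u , m) is the edge to (z , ℓ(u,z)⁻¹ m), so twins of the
-- lift project to twins of Δ.  Condition (i) amounts to twins of Δ sending equal voltages
-- to each common neighbour.  Given that, (u , m) and (v , m) are twins whenever u ∼ v; and
-- if (u , m) ∼ (v , n), lifting a dart out of u (there are no isolated vertices) yields a
-- common neighbour (z , k) with m k⁻¹ = ℓ(u,z) = ℓ(v,z) = n k⁻¹, so m = n.  Conversely,
-- (ii) with m = n = ε makes (u , ε) and (v , ε) twins, and comparing their edges to a
-- lifted common neighbour gives ℓ(u,z) = ℓ(v,z).
module Submission where

open import Defs
open import Level using (Level; _⊔_)
open import Data.Product using (_×_; _,_; proj₁; proj₂)
open import Function.Base using (_∘_)
open import Function.Bundles using (_⇔_; mk⇔; Equivalence)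
open import Algebra.Bundles using (Group)
open import Relation.Binary.PropositionalEquality using (cong)
open import Function.Properties.Equivalence using () renaming (sym to ⇔-sym)
import Algebra.Properties.Group as GroupProperties
import Algebra.Properties.Quasigroup as QuasigroupProperties
import Relation.Binary.Reasoning.Setoid as SetoidReasoning

sameNbrs-sym : ∀ {a b} (Δ : Graph a b) {u v} → SameNbrs Δ u v → SameNbrs Δ v u
sameNbrs-sym Δ s z = ⇔-sym (s z)

module TwinLifts {a b c ℓ : Level} (Δ : Graph a b) (N : Group c ℓ) (L : Voltage Δ N) where
  open Graph Δ
  open Group N
  open GroupProperties N
  open QuasigroupProperties quasigroup using (cancelʳ)
  open Voltage L
  open Equivalence

  TwinsReceiveEqualVoltages : Set (a ⊔ b ⊔ ℓ)
  TwinsReceiveEqualVoltages = ∀ u v w → SameNbrs Δ u v → (q : v ⊥ w) → (r : w ⊥ u) →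
    volt w u r ≈ volt w v (⊥-sym q)

  SendEqualVoltages : V → V → Set (a ⊔ b ⊔ ℓ)
  SendEqualVoltages u v = ∀ {z} (p : u ⊥ z) (q : v ⊥ z) → volt u z p ≈ volt v z q

  TwinsSendEqualVoltages : Set (a ⊔ b ⊔ ℓ)
  TwinsSendEqualVoltages = ∀ {u v} → SameNbrs Δ u v → SendEqualVoltages u v

  volt-irrelevant : ∀ {u v} (p q : u ⊥ v) → volt u v p ≈ volt u v q
  volt-irrelevant {u} {v} p q = reflexive (cong (volt u v) (⊥-prop p q))

  volt-flip : ∀ {u v} (p : u ⊥ v) (q : v ⊥ u) → volt u v p ≈ volt v u q ⁻¹
  volt-flip {u} {v} p q = trans (volt-inv u v p) (⁻¹-cong (volt-irrelevant (⊥-sym p) q))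

  twinsReceive⇔twinsSend : TwinsReceiveEqualVoltages ⇔ TwinsSendEqualVoltages
  twinsReceive⇔twinsSend = mk⇔ receive⇒send send⇒receive
    where
    receive⇒send : TwinsReceiveEqualVoltages → TwinsSendEqualVoltages
    receive⇒send receive {u} {v} s {z} p q = begin
      volt u z p             ≈⟨ volt-flip p (⊥-sym p) ⟩
      volt z u (⊥-sym p) ⁻¹  ≈⟨ ⁻¹-cong (receive u v z s q (⊥-sym p)) ⟩
      volt z v (⊥-sym q) ⁻¹  ≈⟨ volt-flip q (⊥-sym q) ⟨
      volt v z q             ∎
      where open SetoidReasoning setoid
    send⇒receive : TwinsSendEqualVoltages → TwinsReceiveEqualVoltages
    send⇒receive send u v w s q r = begin
      volt w u r             ≈⟨ volt-flip r (⊥-sym r) ⟩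
      volt u w (⊥-sym r) ⁻¹  ≈⟨ ⁻¹-cong (send s (⊥-sym r) q) ⟩
      volt v w q ⁻¹          ≈⟨ volt-flip (⊥-sym q) q ⟨
      volt w v (⊥-sym q)     ∎
      where open SetoidReasoning setoid

  liftDart : ∀ {u z} m (p : u ⊥ z) → LiftAdj Δ N L (u , m) (z , volt u z p ⁻¹ ∙ m)
  liftDart m p = p , (begin
    x                      ≈⟨ \\-leftDividesˡ m x ⟨
    m ∙ (m ⁻¹ ∙ x)         ≈⟨ ∙-congˡ (⁻¹-anti-homo-\\ x m) ⟨
    m ∙ (x ⁻¹ ∙ m) ⁻¹      ∎)
    where
    x = volt _ _ p
    open SetoidReasoning setoid

  liftTwins⇒twins : ∀ {u m v n} → LiftSameNbrs Δ N L (u , m) (v , n) → SameNbrs Δ u v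
  liftTwins⇒twins {m = m} {n = n} t z = mk⇔
    (λ p → proj₁ (to   (t (z , _)) (liftDart m p)))
    (λ q → proj₁ (from (t (z , _)) (liftDart n q)))

  liftTwins⇒sendEqualVoltages : ∀ {u v m} → LiftSameNbrs Δ N L (u , m) (v , m) →
    SendEqualVoltages u v
  liftTwins⇒sendEqualVoltages {u} {v} {m} t {z} p q with to (t (z , _)) (liftDart m p)
  ... | q′ , e = begin
    volt u z p   ≈⟨ proj₂ (liftDart m p) ⟩
    m ∙ _ ⁻¹     ≈⟨ e ⟨
    volt v z q′  ≈⟨ volt-irrelevant q′ q ⟩
    volt v z q   ∎
    where open SetoidReasoning setoid

  liftTwins⇒sameFibre : NoIsolated Δ → TwinsSendEqualVoltages →
    ∀ {u m v n} → LiftSameNbrs Δ N L (u , m) (v , n) → m ≈ n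
  liftTwins⇒sameFibre noIsolated send {u} {m} {v} {n} t with noIsolated u
  ... | z , p with to (t (z , _)) (liftDart m p)
  ... | q , e = cancelʳ _ m n (begin
    m ∙ _ ⁻¹     ≈⟨ proj₂ (liftDart m p) ⟨
    volt u z p   ≈⟨ send (liftTwins⇒twins t) p q ⟩
    volt v z q   ≈⟨ e ⟩
    n ∙ _ ⁻¹     ∎)
    where open SetoidReasoning setoid

  twins⇒liftTwins : TwinsSendEqualVoltages →
    ∀ {u m v n} → m ≈ n × SameNbrs Δ u v → LiftSameNbrs Δ N L (u , m) (v , n)
  twins⇒liftTwins send (m≈n , s) z =
    mk⇔ (liftAdj-transfer m≈n s) (liftAdj-transfer (sym m≈n) (sameNbrs-sym Δ s))
    where
    liftAdj-transfer : ∀ {u m v n} → m ≈ n → SameNbrs Δ u v →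
      LiftAdj Δ N L (u , m) z → LiftAdj Δ N L (v , n) z
    liftAdj-transfer {m = m} {n = n} m≈n s (p , e) = q , (begin
      volt _ _ q   ≈⟨ send s p q ⟨
      volt _ _ p   ≈⟨ e ⟩
      m ∙ _ ⁻¹     ≈⟨ ∙-congʳ m≈n ⟩
      n ∙ _ ⁻¹     ∎)
      where
      q = to (s _) p
      open SetoidReasoning setoid

  LiftTwinsCharacterisation : Set (a ⊔ b ⊔ c ⊔ ℓ)
  LiftTwinsCharacterisation = ∀ u m v n →
    LiftSameNbrs Δ N L (u , m) (v , n) ⇔ (m ≈ n × SameNbrs Δ u v)

  twinsSend⇒liftTwinsCharacterisation : NoIsolated Δ → TwinsSendEqualVoltages →
    LiftTwinsCharacterisation
  twinsSend⇒liftTwinsCharacterisation noIsolated send u m v n = mk⇔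
    (λ t → liftTwins⇒sameFibre noIsolated send t , liftTwins⇒twins t)
    (twins⇒liftTwins send)

  liftTwinsCharacterisation⇒twinsSend : LiftTwinsCharacterisation → TwinsSendEqualVoltages
  liftTwinsCharacterisation⇒twinsSend lift {u} {v} s =
    liftTwins⇒sendEqualVoltages (from (lift u ε v ε) (refl , s))

lemma2p4 : {a b c ℓ : Level} (Δ : Graph a b) (N : Group c ℓ) (L : Voltage Δ N) →
    NoIsolated Δ →
    (-- (i)
     (∀ u v w → SameNbrs Δ u v → (q : Graph._⊥_ Δ v w) →
        (r : Graph._⊥_ Δ w u) →
        Group._≈_ N (Voltage.volt L w u r) (Voltage.volt L w v (Graph.⊥-sym Δ q)))
     ⇔
     -- (ii)
     (∀ u m v n → LiftSameNbrs Δ N L (u , m) (v , n) ⇔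
        (Group._≈_ N m n × SameNbrs Δ u v)))
lemma2p4 Δ N L noIsolated = mk⇔
  (twinsSend⇒liftTwinsCharacterisation noIsolated ∘ to twinsReceive⇔twinsSend)
  (from twinsReceive⇔twinsSend ∘ liftTwinsCharacterisation⇒twinsSend)
  where
  open TwinLifts Δ N L
  open Equivalence
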